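{- Let $n\ge1$. Every tree transposition on $n$ elements is a $1$-transposition.
   Context: For a permutation $\sigma$ of $[n]$ and integers $1\le i<j<k\le n+1$, with $q=k+i-j$, the transposition $\delta_{i,j,k}$ applied to $\sigma$ gives $\delta$ with $\delta(t)=\sigma(t)$ for $t<i$, $\delta(t)=\sigma(t+j-i)$ for $i\le t<q$, $\delta(t)=\sigma(t+j-k)$ for $q\le t<k$, $\delta(t)=\sigma(t)$ for $k\le t\le n$ (swapping the consecutive blocks $\sigma(i..j-1)$ and $\sigma(j..k-1)$). It is a $1$-transposition if $j=i+1$ or $k=j+1$. A full binary tree is a rooted ordered tree whose nodes are leaves or internal nodes with exactly two children. For one with $n$ internal nodes, label internal nodes $1,\dots,n$ in in-order; the associated permutation is the sequence of labels in pre-order. A right rotation at an internal node $a$ whose left child $b$ is internal, with $C,D$ the subtrees of $b$ and $E$ the right subtree of $a$, replaces the subtree at $a$ by the tree with root $b$, left subtree $C$, right child $a$ having subtrees $D,E$; a left rotation is its inverse. $d(T_1,T_2)$ is the minimum number of rotations transforming $T_1$ into $T_2$. A transposition $\delta_{i,j,k}$ is a tree transposition if there exist full binary trees $T_1,T_2$ with $n$ internal nodes, associated permutations $\sigma,\tau$, with $d(T_1,T_2)=1$ and $\delta_{i,j,k}$ applied to $\sigma$ equal to $\tau$. -}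

module Defs where

open import Data.Nat using (ℕ; zero; suc; _+_; _∸_)
open import Data.List using (List; []; _∷_; _++_; take; drop)
open import Data.Product using (Σ; _×_)
open import Data.Sum using (_⊎_)
open import Relation.Binary.PropositionalEquality using (_≡_)
open import Relation.Nullary using (¬_)

data Tree : Set where
  leaf : Tree
  node : Tree → Tree → Tree

size : Tree → ℕ
size leaf       = 0
size (node l r) = suc (size l + size r)

-- Internal nodes labelled by in-order position, starting after offset o;
-- returns the labels listed in pre-order.
preorderFrom : ℕ → Tree → List ℕ
preorderFrom o leaf       = []
preorderFrom o (node l r) =
  suc (o + size l) ∷ (preorderFrom o l ++ preorderFrom (suc (o + size l)) r)

-- The permutation associated to a full binary tree (labels 1..n, in-order
-- labelling, read in pre-order), written as the list σ(1),...,σ(n).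
perm : Tree → List ℕ
perm = preorderFrom 0

data Rotation : Tree → Tree → Set where
  rotR  : ∀ C D E → Rotation (node (node C D) E) (node C (node D E))
  rotL  : ∀ C D E → Rotation (node C (node D E)) (node (node C D) E)
  inL   : ∀ {A A'} B → Rotation A A' → Rotation (node A B) (node A' B)
  inR   : ∀ A {B B'} → Rotation B B' → Rotation (node A B) (node A B')

Dist1 : Tree → Tree → Set
Dist1 T₁ T₂ = Rotation T₁ T₂ × ¬ (T₁ ≡ T₂)

-- The transposition δ_{i,j,k} (1-indexed positions) applied to a sequence σ:
-- swaps the consecutive blocks σ(i..j-1) and σ(j..k-1).
applyδ : ℕ → ℕ → ℕ → List ℕ → List ℕ
applyδ i j k σ =
  take (i ∸ 1) σ
  ++ drop (j ∸ 1) (take (k ∸ 1) σ)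
  ++ drop (i ∸ 1) (take (j ∸ 1) σ)
  ++ drop (k ∸ 1) σ

TreeTransposition : ℕ → ℕ → ℕ → ℕ → Set
TreeTransposition n i j k =
  Σ Tree λ T₁ → Σ Tree λ T₂ →
    size T₁ ≡ n × size T₂ ≡ n × Dist1 T₁ T₂ × applyδ i j k (perm T₁) ≡ perm T₂

OneTransposition : ℕ → ℕ → ℕ → Set
OneTransposition i j k = (j ≡ suc i) ⊎ (k ≡ suc j)

-- In the pre-order word of a tree, a rotation takes a block a b B (a the
-- rotated node, b its left child, B the pre-order of b's left subtree) to
-- b B a, or back.  So a rotation moves a single letter across a block, and
-- since the labels are distinct, a swap of two adjacent blocks U V can only
-- be such a move when U or V is a single letter.
module Submission where

open import Defs
open import Data.Nat using (ℕ; suc; _≤_; _<_; _+_; _∸_; _⊓_; s≤s)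
open import Data.Nat.Properties
open import Data.List using (List; []; _∷_; _++_; take; drop; length)
open import Data.List.Properties
  using (++-assoc; length-++; take++drop≡id; take-take; length-take; length-drop; ∷-injectiveˡ; ∷-injectiveʳ)
open import Data.List.Membership.Propositional.Properties using (∈-++⁺ʳ)
open import Data.List.Relation.Unary.All as All using (All; []; _∷_)
open import Data.List.Relation.Unary.All.Properties using (++⁺)
open import Data.List.Relation.Unary.Any using (here)
open import Data.List.Relation.Unary.AllPairs using ([]; _∷_)
open import Data.List.Relation.Unary.Unique.Propositional using (Unique)
open import Data.List.Relation.Unary.Unique.Propositional.Properties
  using (Unique[x∷xs]⇒x∉xs) renaming (++⁺ to Unique-++⁺)
open import Data.List.Relation.Binary.Disjoint.Propositional using (Disjoint)
open import Data.Product using (_,_)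
open import Data.Sum using (_⊎_; inj₁; inj₂)
import Data.Sum as Sum
open import Data.Empty using (⊥-elim)
open import Function using (_∘′_)
open import Relation.Binary.PropositionalEquality
open import Relation.Nullary using (¬_)

private
  variable
    m : ℕ
    x y : ℕ
    xs ys zs : List ℕ
    T₁ T₂ : Tree

separated⇒Disjoint : All (_≤ m) xs → All (m <_) ys → Disjoint xs ys
separated⇒Disjoint xs≤m m<ys (v∈xs , v∈ys) =
  <⇒≱ (All.lookup m<ys v∈ys) (All.lookup xs≤m v∈xs)

¬Unique-repeat : x ≡ y → ∀ ys {zs} → ¬ Unique (x ∷ ys ++ y ∷ zs)
¬Unique-repeat refl ys u = Unique[x∷xs]⇒x∉xs u (∈-++⁺ʳ ys (here refl))

preorderFrom-lower : ∀ o T → All (o <_) (preorderFrom o T)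
preorderFrom-lower o leaf = []
preorderFrom-lower o (node l r) =
  s≤s (m≤m+n o (size l)) ∷
  ++⁺ (preorderFrom-lower o l)
      (All.map (<-trans (s≤s (m≤m+n o (size l)))) (preorderFrom-lower _ r))

preorderFrom-upper : ∀ o T → All (_≤ o + size T) (preorderFrom o T)
preorderFrom-upper o leaf = []
preorderFrom-upper o (node l r) =
  root≤ ∷ ++⁺ (All.map (λ x≤ → ≤-trans x≤ (≤-trans (n≤1+n _) root≤)) (preorderFrom-upper o l))
              (subst (λ b → All (_≤ b) (preorderFrom (suc (o + size l)) r)) shift (preorderFrom-upper _ r))
  where
  shift : suc (o + size l) + size r ≡ o + size (node l r)
  shift = trans (cong suc (+-assoc o (size l) (size r))) (sym (+-suc o (size l + size r)))
  root≤ : suc (o + size l) ≤ o + size (node l r)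
  root≤ = ≤-trans (m≤m+n _ (size r)) (≤-reflexive shift)

preorderFrom-unique : ∀ o T → Unique (preorderFrom o T)
preorderFrom-unique o leaf = []
preorderFrom-unique o (node l r) =
  ++⁺ (All.map (λ x≤ → >⇒≢ (s≤s x≤)) (preorderFrom-upper o l))
      (All.map <⇒≢ (preorderFrom-lower _ r))
  ∷ Unique-++⁺ (preorderFrom-unique o l) (preorderFrom-unique _ r)
      (separated⇒Disjoint (preorderFrom-upper o l)
                          (All.map (<-trans (n<1+n _)) (preorderFrom-lower _ r)))

length-preorderFrom : ∀ o T → length (preorderFrom o T) ≡ size T
length-preorderFrom o leaf = refl
length-preorderFrom o (node l r) =
  cong suc (trans (length-++ (preorderFrom o l))
                  (cong₂ _+_ (length-preorderFrom o l) (length-preorderFrom _ r)))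

size-rotation : Rotation T₁ T₂ → size T₁ ≡ size T₂
size-rotation (rotR C D E) =
  cong suc (trans (cong suc (+-assoc (size C) (size D) (size E)))
                  (sym (+-suc (size C) (size D + size E))))
size-rotation (rotL C D E) = sym (size-rotation (rotR C D E))
size-rotation (inL B r)    = cong (λ s → suc (s + size B)) (size-rotation r)
size-rotation (inR A r)    = cong (λ s → suc (size A + s)) (size-rotation r)

infix 4 _⟶_

data _⟶_ : List ℕ → List ℕ → Set where
  cycle : ∀ a b B S → a ∷ b ∷ B ++ S ⟶ b ∷ B ++ a ∷ S
  there : ∀ x → xs ⟶ ys → x ∷ xs ⟶ x ∷ ys

⟶-++ˡ : ∀ zs → xs ⟶ ys → zs ++ xs ⟶ zs ++ ys
⟶-++ˡ []       step = step
⟶-++ˡ (z ∷ zs) step = there z (⟶-++ˡ zs step)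

⟶-++ʳ : ∀ zs → xs ⟶ ys → xs ++ zs ⟶ ys ++ zs
⟶-++ʳ zs (cycle a b B S) rewrite ++-assoc B S zs | ++-assoc B (a ∷ S) zs = cycle a b B (S ++ zs)
⟶-++ʳ zs (there x step) = there x (⟶-++ʳ zs step)

preorderFrom-rotR : ∀ o C D E →
  preorderFrom o (node (node C D) E) ⟶ preorderFrom o (node C (node D E))
preorderFrom-rotR o C D E
  rewrite ++-assoc (preorderFrom o C) (preorderFrom (suc (o + size C)) D)
                   (preorderFrom (suc (o + size (node C D))) E)
        | +-suc o (size C + size D)
        | +-assoc o (size C) (size D)
  = cycle _ _ (preorderFrom o C) _

preorderFrom-rotation : ∀ o → Rotation T₁ T₂ →
  preorderFrom o T₁ ⟶ preorderFrom o T₂ ⊎ preorderFrom o T₂ ⟶ preorderFrom o T₁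
preorderFrom-rotation o (rotR C D E) = inj₁ (preorderFrom-rotR o C D E)
preorderFrom-rotation o (rotL C D E) = inj₂ (preorderFrom-rotR o C D E)
preorderFrom-rotation o (inL B r) rewrite size-rotation r =
  Sum.map (λ step → there _ (⟶-++ʳ _ step)) (λ step → there _ (⟶-++ʳ _ step))
          (preorderFrom-rotation o r)
preorderFrom-rotation o (inR A r) =
  Sum.map (λ step → there _ (⟶-++ˡ _ step)) (λ step → there _ (⟶-++ˡ _ step))
          (preorderFrom-rotation _ r)

⟶-blockSwap : xs ⟶ ys → Unique xs → ∀ A u U v V D →
  xs ≡ A ++ u ∷ U ++ v ∷ V ++ D → ys ≡ A ++ v ∷ V ++ u ∷ U ++ D → U ≡ []
⟶-blockSwap (there _ step) (_ ∷ uniq) (_ ∷ A) u U v V D xs≡ ys≡ =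
  ⟶-blockSwap step uniq A u U v V D (∷-injectiveʳ xs≡) (∷-injectiveʳ ys≡)
⟶-blockSwap (there _ step) uniq [] u U v V D xs≡ ys≡ =
  ⊥-elim (¬Unique-repeat (trans (sym (∷-injectiveˡ xs≡)) (∷-injectiveˡ ys≡)) U
                         (subst Unique xs≡ uniq))
⟶-blockSwap (cycle a b B S) ((a≢b ∷ _) ∷ _) (_ ∷ A) u U v V D xs≡ ys≡ =
  ⊥-elim (a≢b (trans (∷-injectiveˡ xs≡) (sym (∷-injectiveˡ ys≡))))
⟶-blockSwap (cycle a b B S) uniq [] u [] v V D xs≡ ys≡ = refl
⟶-blockSwap (cycle a b B S) uniq [] u (_ ∷ U) v V D xs≡ ys≡
  with subst Unique xs≡ uniq
... | _ ∷ uniq′ =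
  ⊥-elim (¬Unique-repeat (trans (sym (∷-injectiveˡ (∷-injectiveʳ xs≡))) (∷-injectiveˡ ys≡)) U uniq′)

rotation-blockSwap : Rotation T₁ T₂ → ∀ A U V D →
  perm T₁ ≡ A ++ U ++ V ++ D → perm T₂ ≡ A ++ V ++ U ++ D →
  0 < length U → 0 < length V → length U ≡ 1 ⊎ length V ≡ 1
rotation-blockSwap {T₁} {T₂} rot A (u ∷ U) (v ∷ V) D σ≡ τ≡ _ _
  with preorderFrom-rotation 0 rot
... | inj₁ step =
  inj₁ (cong (suc ∘′ length) (⟶-blockSwap step (preorderFrom-unique 0 T₁) A u U v V D σ≡ τ≡))
... | inj₂ step =
  inj₂ (cong (suc ∘′ length) (⟶-blockSwap step (preorderFrom-unique 0 T₂) A v V u U D τ≡ σ≡))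

take-prefix : ∀ {A : Set} {p q} (xs : List A) → p ≤ q → take q xs ≡ take p xs ++ drop p (take q xs)
take-prefix {p = p} {q} xs p≤q = begin
  take q xs                                    ≡⟨ take++drop≡id p (take q xs) ⟨
  take p (take q xs) ++ drop p (take q xs)     ≡⟨ cong (_++ drop p (take q xs)) (take-take p q xs) ⟩
  take (p ⊓ q) xs ++ drop p (take q xs)        ≡⟨ cong (λ s → take s xs ++ drop p (take q xs)) (m≤n⇒m⊓n≡m p≤q) ⟩
  take p xs ++ drop p (take q xs)              ∎
  where open ≡-Reasoning

split-at-three-cuts : ∀ {A : Set} {p q r} (xs : List A) → p ≤ q → q ≤ r →
  xs ≡ take p xs ++ drop p (take q xs) ++ drop q (take r xs) ++ drop r xs
split-at-three-cuts {p = p} {q} {r} xs p≤q q≤r = begin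
  xs                       ≡⟨ take++drop≡id r xs ⟨
  take r xs ++ D           ≡⟨ cong (_++ D) (take-prefix xs q≤r) ⟩
  (take q xs ++ V) ++ D    ≡⟨ ++-assoc (take q xs) V D ⟩
  take q xs ++ V ++ D      ≡⟨ cong (_++ V ++ D) (take-prefix xs p≤q) ⟩
  (take p xs ++ U) ++ V ++ D ≡⟨ ++-assoc (take p xs) U (V ++ D) ⟩
  take p xs ++ U ++ V ++ D ∎
  where
  open ≡-Reasoning
  U = drop p (take q xs)
  V = drop q (take r xs)
  D = drop r xs

length-drop-take : ∀ {A : Set} p {q} (xs : List A) → q ≤ length xs → length (drop p (take q xs)) ≡ q ∸ p
length-drop-take p {q} xs q≤len =
  trans (length-drop p (take q xs)) (cong (_∸ p) (trans (length-take q xs) (m≤n⇒m⊓n≡m q≤len)))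

∸≡1⇒≡suc : ∀ {p q} → p ≤ q → q ∸ p ≡ 1 → q ≡ suc p
∸≡1⇒≡suc {p} p≤q q∸p≡1 = trans (sym (m∸n+n≡m p≤q)) (cong (_+ p) q∸p≡1)

lemma3 : (n : ℕ) → 1 ≤ n → (i j k : ℕ) → 1 ≤ i → i < j → j < k → k ≤ suc n →
    TreeTransposition n i j k → OneTransposition i j k
lemma3 _ _ (suc i) (suc j) (suc k) _ (s≤s i<j) (s≤s j<k) (s≤s k≤n)
       (T₁ , T₂ , refl , _ , (rot , _) , δσ≡τ) =
  Sum.map (cong suc ∘′ gap≡1 (<⇒≤ i<j) j≤len) (cong suc ∘′ gap≡1 (<⇒≤ j<k) k≤len)
    (rotation-blockSwap rot (take i σ) (drop i (take j σ)) (drop j (take k σ)) (drop k σ)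
                        (split-at-three-cuts σ (<⇒≤ i<j) (<⇒≤ j<k)) (sym δσ≡τ)
                        (gap>0 i<j j≤len) (gap>0 j<k k≤len))
  where
  σ : List ℕ
  σ = perm T₁
  k≤len : k ≤ length σ
  k≤len = subst (k ≤_) (sym (length-preorderFrom 0 T₁)) k≤n
  j≤len : j ≤ length σ
  j≤len = ≤-trans (<⇒≤ j<k) k≤len
  gap>0 : ∀ {p q} → p < q → q ≤ length σ → 0 < length (drop p (take q σ))
  gap>0 {p} p<q q≤len = subst (0 <_) (sym (length-drop-take p σ q≤len)) (m<n⇒0<n∸m p<q)
  gap≡1 : ∀ {p q} → p ≤ q → q ≤ length σ → length (drop p (take q σ)) ≡ 1 → q ≡ suc p
  gap≡1 {p} p≤q q≤len len≡1 = ∸≡1⇒≡suc p≤q (trans (sym (length-drop-take p σ q≤len)) len≡1)
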